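{- Let $q$ be a prime power, $E=\mathbb{F}_q^n$, let $\mathcal{M}_1=(\mathcal{L}(E),\rho_1)$, $\mathcal{M}_2=(\mathcal{L}(E),\rho_2)$ be two $q$-matroids with collections of independent spaces $\mathcal{I}_1,\mathcal{I}_2$, let $\lambda\in\mathbb{Q}$ with $0<\lambda<1$, let $\mathcal{M}=\lambda\mathcal{M}_1+(1-\lambda)\mathcal{M}_2$ and $\mu=\mathrm{denom}(\lambda)$. Then every $X\in\mathcal{I}_1\cup\mathcal{I}_2$ is $\mu$-independent in $\mathcal{M}$, i.e. $\mathcal{I}_1\cup\mathcal{I}_2\subseteq\mathcal{I}_\mu(\mathcal{M})$.
   Context: A $q$-matroid is $(\mathcal{L}(E),\rho)$ with $\rho$ integer-valued, $0\le\rho(A)\le\dim A$, monotone and submodular; $A$ is independent if $\rho(A)=\dim A$. $\lambda\mathcal{M}_1+(1-\lambda)\mathcal{M}_2$ has rank function $\rho=\lambda\rho_1+(1-\lambda)\rho_2$. $\mathrm{denom}(\lambda)$ is $b$ where $\lambda=a/b$ in lowest terms. A space $I$ is $\mu$-independent in $\mathcal{M}$ if $\rho(J)\ge\dim(J)/\mu$ for all $J\le I$; $\mathcal{I}_\mu(\mathcal{M})$ is the set of such spaces. -}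

module Defs where

open import Level using (Level; _⊔_)
open import Algebra.Bundles using (CommutativeRing)
import Algebra.Definitions.RawMonoid as RawMonoidDefs
open import Data.Nat using (ℕ; zero; suc; _^_)
import Data.Nat as ℕ
open import Data.Integer using (+_)
open import Data.Rational as ℚ using (ℚ; 1ℚ; ↧ₙ_)
open import Data.Nat.Primality using (Prime)
open import Data.Fin using (Fin)
open import Data.Product using (Σ; ∃; _×_; _,_)
open import Data.Vec.Functional using (Vector; _++_)
open import Function.Bundles using (Bijection)
open import Relation.Binary.PropositionalEquality using (_≡_; setoid)
open import Relation.Nullary using (¬_)

record IsFieldRing {c ℓ} (R : CommutativeRing c ℓ) : Set (c ⊔ ℓ) where
  open CommutativeRing R
  field
    1≉0     : ¬ (1# ≈ 0#)
    inverse : ∀ x → ¬ (x ≈ 0#) → Σ Carrier (λ y → (x * y) ≈ 1#)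

IsPrimePower : ℕ → Set
IsPrimePower q = Σ ℕ (λ p → Σ ℕ (λ k → Prime p × q ≡ p ^ suc k))

record FiniteField c ℓ (q : ℕ) : Set (Level.suc (c ⊔ ℓ)) where
  field
    ring     : CommutativeRing c ℓ
    isField  : IsFieldRing ring
    counting : Bijection (setoid (Fin q)) (CommutativeRing.setoid ring)

-- A subspace of E is represented by a finite family of generators
-- (it is the span of the family); two families represent the same
-- element of 𝓛(E) iff their spans coincide.

module Subspaces {c ℓ} (R : CommutativeRing c ℓ) (n : ℕ) where
  open CommutativeRing R
  open RawMonoidDefs +-rawMonoid using (sum)

  V : Set c
  V = Vector Carrier n

  _≈ᵥ_ : V → V → Set ℓ
  u ≈ᵥ v = ∀ j → u j ≈ v j

  0ᵥ : V
  0ᵥ j = 0#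

  comb : ∀ {m} → (Fin m → V) → (Fin m → Carrier) → V
  comb g k j = sum (λ i → k i * g i j)

  Gens : Set c
  Gens = Σ ℕ (λ m → Fin m → V)

  _∈ˢ_ : V → Gens → Set (c ⊔ ℓ)
  v ∈ˢ (m , g) = Σ (Fin m → Carrier) (λ k → v ≈ᵥ comb g k)

  _≤ˢ_ : Gens → Gens → Set (c ⊔ ℓ)
  A ≤ˢ B = ∀ v → v ∈ˢ A → v ∈ˢ B

  _≃ˢ_ : Gens → Gens → Set (c ⊔ ℓ)
  A ≃ˢ B = (A ≤ˢ B) × (B ≤ˢ A)

  _+ˢ_ : Gens → Gens → Gens
  (m , g) +ˢ (k , h) = (m ℕ.+ k , g ++ h)

  IsMeet : Gens → Gens → Gens → Set (c ⊔ ℓ)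
  IsMeet A B C = ∀ v → ((v ∈ˢ C → (v ∈ˢ A × v ∈ˢ B)) × ((v ∈ˢ A × v ∈ˢ B) → v ∈ˢ C))

  LinIndep : ∀ {d} → (Fin d → V) → Set (c ⊔ ℓ)
  LinIndep {d} b = ∀ (k : Fin d → Carrier) → comb b k ≈ᵥ 0ᵥ → ∀ i → k i ≈ 0#

  HasDim : Gens → ℕ → Set (c ⊔ ℓ)
  HasDim A d = Σ (Fin d → V) (λ b → LinIndep b × ((d , b) ≃ˢ A))

  record IsQMatroid (ρ : Gens → ℕ) : Set (c ⊔ ℓ) where
    field
      well-defined : ∀ A B → A ≃ˢ B → ρ A ≡ ρ B
      bounded      : ∀ A d → HasDim A d → ρ A ℕ.≤ d
      monotone     : ∀ A B → A ≤ˢ B → ρ A ℕ.≤ ρ B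
      submodular   : ∀ A B C → IsMeet A B C → ρ (A +ˢ B) ℕ.+ ρ C ℕ.≤ ρ A ℕ.+ ρ B

  Independent : (Gens → ℕ) → Gens → Set (c ⊔ ℓ)
  Independent ρ A = Σ ℕ (λ d → HasDim A d × ρ A ≡ d)

  mixRank : ℚ → (Gens → ℕ) → (Gens → ℕ) → Gens → ℚ
  mixRank λ' ρ₁ ρ₂ A =
    (λ' ℚ.* ((+ ρ₁ A) ℚ./ 1)) ℚ.+ ((1ℚ ℚ.- λ') ℚ.* ((+ ρ₂ A) ℚ./ 1))

  denom : ℚ → ℕ
  denom λ' = ↧ₙ λ'

  μIndependent : (μ : ℕ) → .{{_ : ℕ.NonZero μ}} → (Gens → ℚ) → Gens → Set (c ⊔ ℓ)
  μIndependent μ ρ I = ∀ J → J ≤ˢ I → ∀ d → HasDim J d → ((+ d) ℚ./ μ) ℚ.≤ ρ J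

{-# OPTIONS --safe #-}
-- Write λ = a/μ in lowest terms; then 1 ≤ a ≤ μ - 1, so both λ and 1 - λ are
-- at least 1/μ. If X is independent in 𝓜ᵢ, then so is every J ≤ X: extending a
-- basis of J by k vectors to a spanning set of X (Steinitz exchange) gives
-- dim J + k ≤ dim X = ρᵢ(X) ≤ ρᵢ(J) + k, because adjoining one vector raises a
-- submodular rank function by at most one. Hence
-- ρ(J) ≥ ρᵢ(J)/μ ≥ dim J/μ.
module Submission where

open import Defs
open import Level using (_⊔_)
open import Algebra.Bundles using (CommutativeRing; Monoid)
open import Data.Nat as ℕ using (ℕ; zero; suc; z≤n)
import Data.Nat.Properties as ℕP
open import Data.Integer as ℤ using (+_; +[1+_]; -[1+_])
import Data.Integer.Properties as ℤP
open import Data.Integer.Tactic.RingSolver using (solve-∀)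
open import Data.Rational as ℚ using (ℚ; mkℚ; 0ℚ; 1ℚ; _<_; _≤_; ↧ₙ_; toℚᵘ; *<*)
import Data.Rational.Properties as ℚP
open import Data.Rational.Unnormalised as ℚᵘ using (ℚᵘ; mkℚᵘ; 1ℚᵘ; 0ℚᵘ; *≤*; *≡*)
import Data.Rational.Unnormalised.Properties as ℚᵘP
open import Data.Fin as Fin using (Fin; zero; suc; _↑ˡ_; _↑ʳ_; punchOut)
import Data.Fin.Properties as FinP
open import Data.Vec.Functional using (Vector; _∷_; _++_; map; zipWith; removeAt)
open import Data.Vec.Functional.Properties using (lookup-++ˡ; lookup-++ʳ)
open import Data.Vec.Functional.Relation.Unary.All.Properties using (++⁺; ++⁻ˡ; ++⁻ʳ)
open import Data.Product using (∃; ∃₂; _×_; _,_; proj₁; proj₂)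
open import Data.Sum as Sum using (_⊎_; inj₁; inj₂)
open import Data.Empty using (⊥-elim)
open import Function using (_∘_)
open import Function.Construct.Symmetry as Symmetry using ()
open import Function.Properties.Bijection using (Bijection⇒Inverse)
open import Function.Properties.Inverse using (Inverse⇒Injection)
open import Relation.Binary.Definitions using (Decidable)
import Relation.Binary.PropositionalEquality as ≡
open import Relation.Binary.PropositionalEquality using (_≡_)
open import Relation.Nullary using (¬_; yes; no)
open import Relation.Nullary.Decidable using (decidable-stable; ¬?; via-injection)

toℚᵘ-/ : ∀ i m → toℚᵘ (i ℚ./ suc m) ℚᵘ.≃ mkℚᵘ i m
toℚᵘ-/ i m = ℚP.toℚᵘ-fromℚᵘ (mkℚᵘ i m)

toℚᵘ-convex : ∀ p x y →
  toℚᵘ (p ℚ.* x ℚ.+ (1ℚ ℚ.- p) ℚ.* y) ℚᵘ.≃ toℚᵘ p ℚᵘ.* toℚᵘ x ℚᵘ.+ (1ℚᵘ ℚᵘ.- toℚᵘ p) ℚᵘ.* toℚᵘ y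
toℚᵘ-convex p x y = begin
  toℚᵘ (p ℚ.* x ℚ.+ (1ℚ ℚ.- p) ℚ.* y)
    ≈⟨ ℚP.toℚᵘ-homo-+ (p ℚ.* x) _ ⟩
  toℚᵘ (p ℚ.* x) ℚᵘ.+ toℚᵘ ((1ℚ ℚ.- p) ℚ.* y)
    ≈⟨ ℚᵘP.+-cong (ℚP.toℚᵘ-homo-* p x) (ℚP.toℚᵘ-homo-* (1ℚ ℚ.- p) y) ⟩
  toℚᵘ p ℚᵘ.* toℚᵘ x ℚᵘ.+ toℚᵘ (1ℚ ℚ.- p) ℚᵘ.* toℚᵘ y
    ≈⟨ ℚᵘP.+-congʳ (toℚᵘ p ℚᵘ.* toℚᵘ x) (ℚᵘP.*-congʳ 1-p) ⟩
  toℚᵘ p ℚᵘ.* toℚᵘ x ℚᵘ.+ (1ℚᵘ ℚᵘ.- toℚᵘ p) ℚᵘ.* toℚᵘ y ∎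
  where
  open ℚᵘP.≃-Reasoning
  1-p : toℚᵘ (1ℚ ℚ.- p) ℚᵘ.≃ 1ℚᵘ ℚᵘ.- toℚᵘ p
  1-p = ℚᵘP.≃-trans (ℚP.toℚᵘ-homo-+ 1ℚ (ℚ.- p)) (ℚᵘP.+-congʳ 1ℚᵘ (ℚP.toℚᵘ-homo‿- p))

frac≤frac*nat : ∀ m {x} y r → x ℕ.≤ y ℕ.* r → mkℚᵘ (+ x) m ℚᵘ.≤ mkℚᵘ (+ y) m ℚᵘ.* mkℚᵘ (+ r) 0
frac≤frac*nat m {x} y r x≤yr = *≤* (≡.subst₂ ℤ._≤_ lhs rhs (ℤ.+≤+ cross))
  where
  cross : x ℕ.* (suc m ℕ.* 1) ℕ.≤ y ℕ.* r ℕ.* suc m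
  cross = ℕP.*-mono-≤ x≤yr (ℕP.≤-reflexive (ℕP.*-identityʳ (suc m)))
  lhs : + (x ℕ.* (suc m ℕ.* 1)) ≡ + x ℤ.* + (suc m ℕ.* 1)
  lhs = ℤP.pos-* x _
  rhs : + (y ℕ.* r ℕ.* suc m) ≡ + y ℤ.* + r ℤ.* + suc m
  rhs = ≡.trans (ℤP.pos-* (y ℕ.* r) _) (≡.cong (ℤ._* + suc m) (ℤP.pos-* y r))

0≤frac*nat : ∀ m y r → 0ℚᵘ ℚᵘ.≤ mkℚᵘ (+ y) m ℚᵘ.* mkℚᵘ (+ r) 0
0≤frac*nat m y r = ℚᵘP.≤-trans (*≤* (ℤ.+≤+ z≤n)) (frac≤frac*nat m y r z≤n)

1-frac≃frac : ∀ a b → 1ℚᵘ ℚᵘ.- mkℚᵘ +[1+ a ] (a ℕ.+ suc b) ℚᵘ.≃ mkℚᵘ +[1+ b ] (a ℕ.+ suc b)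
1-frac≃frac a b = *≡* (cross-multiplied +[1+ a ] +[1+ b ])
  where
  cross-multiplied : ∀ p q →
    (+ 1 ℤ.* (p ℤ.+ q) ℤ.+ ℤ.- p ℤ.* + 1) ℤ.* (p ℤ.+ q) ≡ q ℤ.* (+ 1 ℤ.* (p ℤ.+ q))
  cross-multiplied = solve-∀

weighted-frac-bound : ∀ m {a b d r₁ r₂} .{{_ : ℕ.NonZero a}} .{{_ : ℕ.NonZero b}} →
  d ℕ.≤ r₁ ⊎ d ℕ.≤ r₂ →
  mkℚᵘ (+ d) m ℚᵘ.≤ mkℚᵘ (+ a) m ℚᵘ.* mkℚᵘ (+ r₁) 0 ℚᵘ.+ mkℚᵘ (+ b) m ℚᵘ.* mkℚᵘ (+ r₂) 0
weighted-frac-bound m {a} {b} {d} {r₁} {r₂} (inj₁ d≤r₁) =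
  ℚᵘP.≤-respˡ-≃ (ℚᵘP.+-identityʳ (mkℚᵘ (+ d) m))
    (ℚᵘP.+-mono-≤ (frac≤frac*nat m a r₁ (ℕP.≤-trans d≤r₁ (ℕP.m≤n*m r₁ a))) (0≤frac*nat m b r₂))
weighted-frac-bound m {a} {b} {d} {r₁} {r₂} (inj₂ d≤r₂) =
  ℚᵘP.≤-respˡ-≃ (ℚᵘP.+-identityˡ (mkℚᵘ (+ d) m))
    (ℚᵘP.+-mono-≤ (0≤frac*nat m a r₁) (frac≤frac*nat m b r₂ (ℕP.≤-trans d≤r₂ (ℕP.m≤n*m r₂ b))))

<⇒≡+suc : ∀ {a m} → a ℕ.< m → ∃ λ b → m ≡ a ℕ.+ suc b
<⇒≡+suc {a} a<m with ℕP.m≤n⇒∃[o]m+o≡n a<m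
... | b , 1+a+b≡m = b , ≡.trans (≡.sym 1+a+b≡m) (≡.sym (ℕP.+-suc a b))

convex-denom-bound : ∀ p → 0ℚ < p → p < 1ℚ → ∀ {d r₁ r₂} → d ℕ.≤ r₁ ⊎ d ℕ.≤ r₂ →
  + d ℚ./ ↧ₙ p ≤ p ℚ.* (+ r₁ ℚ./ 1) ℚ.+ (1ℚ ℚ.- p) ℚ.* (+ r₂ ℚ./ 1)
convex-denom-bound (mkℚ (+ 0) _ _) (*<* (ℤ.+<+ ()))
convex-denom-bound (mkℚ -[1+ _ ] _ _) (*<* ())
convex-denom-bound p@(mkℚ +[1+ a ] m _) _ (*<* (ℤ.+<+ 1+a<1+m)) {d} {r₁} {r₂} d≤r
  -- p = (1 + a)/(2 + a + b), so 1 - p = (1 + b)/(2 + a + b)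
  with <⇒≡+suc (≡.subst₂ ℕ._<_ (ℕP.*-identityʳ a) (ℕP.+-identityʳ m) (ℕ.s≤s⁻¹ 1+a<1+m))
... | b , ≡.refl = ℚP.toℚᵘ-cancel-≤ (begin
  toℚᵘ (+ d ℚ./ suc m)
    ≃⟨ toℚᵘ-/ (+ d) m ⟩
  mkℚᵘ (+ d) m
    ≤⟨ weighted-frac-bound m {suc a} {suc b} d≤r ⟩
  L ℚᵘ.* R₁ ℚᵘ.+ mkℚᵘ +[1+ b ] m ℚᵘ.* R₂
    ≃⟨ ℚᵘP.+-congʳ (L ℚᵘ.* R₁) (ℚᵘP.*-congʳ (1-frac≃frac a b)) ⟨
  L ℚᵘ.* R₁ ℚᵘ.+ (1ℚᵘ ℚᵘ.- L) ℚᵘ.* R₂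
    ≃⟨ ℚᵘP.+-cong (ℚᵘP.*-congˡ {L} (toℚᵘ-/ (+ r₁) 0)) (ℚᵘP.*-congˡ {1ℚᵘ ℚᵘ.- L} (toℚᵘ-/ (+ r₂) 0)) ⟨
  L ℚᵘ.* toℚᵘ (+ r₁ ℚ./ 1) ℚᵘ.+ (1ℚᵘ ℚᵘ.- L) ℚᵘ.* toℚᵘ (+ r₂ ℚ./ 1)
    ≃⟨ toℚᵘ-convex p (+ r₁ ℚ./ 1) (+ r₂ ℚ./ 1) ⟨
  toℚᵘ (p ℚ.* (+ r₁ ℚ./ 1) ℚ.+ (1ℚ ℚ.- p) ℚ.* (+ r₂ ℚ./ 1)) ∎)
  where
  open ℚᵘP.≤-Reasoning
  L R₁ R₂ : ℚᵘ
  L = mkℚᵘ +[1+ a ] m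
  R₁ = mkℚᵘ (+ r₁) 0
  R₂ = mkℚᵘ (+ r₂) 0

module MonoidSum {a ℓ} (M : Monoid a ℓ) where
  open Monoid M
  open import Algebra.Properties.Monoid.Sum M using (sum)

  sum-split : ∀ m {k} (f : Vector Carrier (m ℕ.+ k)) →
              sum f ≈ sum (f ∘ (_↑ˡ k)) ∙ sum (f ∘ (m ↑ʳ_))
  sum-split zero    f = sym (identityˡ _)
  sum-split (suc m) f = trans (∙-congˡ (sum-split m (f ∘ suc))) (sym (assoc _ _ _))

module SpanProperties {c ℓ} (R : CommutativeRing c ℓ) (n : ℕ) where
  open CommutativeRing R hiding (zero)
  open Subspaces R n
  open import Algebra.Properties.CommutativeMonoid.Sum +-commutativeMonoid
    using (sum-cong-≋; sum-cong-≗; sum-replicate-zero; sum-remove; ∑-distrib-+)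
  open import Algebra.Properties.Semiring.Sum semiring using (*-distribˡ-sum)
  open MonoidSum +-monoid using (sum-split)

  -- Tighter than _≈ᵥ_ and _∈ˢ_ from Defs, which have the default fixity 20.
  infixl 21 _+ᵥ_
  infixr 22 _·ᵥ_

  _+ᵥ_ : V → V → V
  _+ᵥ_ = zipWith _+_

  _·ᵥ_ : Carrier → V → V
  a ·ᵥ v = map (a *_) v

  ⟨_⟩ : V → Gens
  ⟨ v ⟩ = 1 , λ _ → v

  0ˢ : Gens
  0ˢ = 0 , λ ()

  comb-zero : ∀ {m} (g : Fin m → V) {κ} → (∀ i → κ i ≈ 0#) → comb g κ ≈ᵥ 0ᵥ
  comb-zero {m} g κ≈0 j =
    trans (sum-cong-≋ (λ i → trans (*-congʳ (κ≈0 i)) (zeroˡ _))) (sum-replicate-zero m)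

  comb-++ : ∀ {m k} (g : Fin m → V) (h : Fin k → V) κ →
            comb (g ++ h) κ ≈ᵥ comb g (κ ∘ (_↑ˡ k)) +ᵥ comb h (κ ∘ (m ↑ʳ_))
  comb-++ {m} {k} g h κ j = trans (sum-split m _) (reflexive (≡.cong₂ _+_
    (sum-cong-≗ (λ i → ≡.cong (λ v → κ (i ↑ˡ k) * v j) (lookup-++ˡ g h i)))
    (sum-cong-≗ (λ i → ≡.cong (λ v → κ (m ↑ʳ i) * v j) (lookup-++ʳ g h i)))))

  comb-removeAt : ∀ {k} (g : Fin (suc k) → V) κ l →
                  comb g κ ≈ᵥ κ l ·ᵥ g l +ᵥ comb (removeAt g l) (removeAt κ l)
  comb-removeAt g κ l j = sum-remove {i = l} (λ i → κ i * g i j)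

  ∈ˢ-resp-≈ᵥ : ∀ H {u v} → u ≈ᵥ v → v ∈ˢ H → u ∈ˢ H
  ∈ˢ-resp-≈ᵥ H u≈v (κ , v≈) = κ , λ j → trans (u≈v j) (v≈ j)

  0ᵥ-∈ˢ : ∀ H → 0ᵥ ∈ˢ H
  0ᵥ-∈ˢ (m , g) = (λ _ → 0#) , λ j → sym (comb-zero g (λ _ → refl) j)

  +ᵥ-∈ˢ : ∀ H {u v} → u ∈ˢ H → v ∈ˢ H → u +ᵥ v ∈ˢ H
  +ᵥ-∈ˢ (m , g) (κ , u≈) (τ , v≈) = (λ i → κ i + τ i) , λ j → trans (+-cong (u≈ j) (v≈ j))
    (trans (sym (∑-distrib-+ (λ i → κ i * g i j) (λ i → τ i * g i j)))
           (sum-cong-≋ (λ i → sym (distribʳ (g i j) (κ i) (τ i)))))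

  ·ᵥ-∈ˢ : ∀ H a {v} → v ∈ˢ H → a ·ᵥ v ∈ˢ H
  ·ᵥ-∈ˢ (m , g) a (κ , v≈) = (λ i → a * κ i) , λ j → trans (*-congˡ (v≈ j))
    (trans (*-distribˡ-sum a (λ i → κ i * g i j))
           (sum-cong-≋ (λ i → sym (*-assoc a (κ i) (g i j)))))

  comb-∈ˢ : ∀ H {m} {g : Fin m → V} → (∀ i → g i ∈ˢ H) → ∀ κ → comb g κ ∈ˢ H
  comb-∈ˢ H {zero}  g∈H κ = 0ᵥ-∈ˢ H
  comb-∈ˢ H {suc m} g∈H κ =
    +ᵥ-∈ˢ H (·ᵥ-∈ˢ H (κ zero) (g∈H zero)) (comb-∈ˢ H (g∈H ∘ suc) (κ ∘ suc))

  δ : ∀ {m} → Fin m → Fin m → Carrier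
  δ zero    zero    = 1#
  δ zero    (suc _) = 0#
  δ (suc _) zero    = 0#
  δ (suc i) (suc l) = δ i l

  comb-δ : ∀ {m} (g : Fin m → V) i → comb g (δ i) ≈ᵥ g i
  comb-δ {suc m} g zero j =
    trans (+-cong (*-identityˡ (g zero j)) (comb-zero (g ∘ suc) (λ _ → refl) j)) (+-identityʳ _)
  comb-δ {suc m} g (suc i) j =
    trans (+-cong (zeroˡ (g zero j)) (comb-δ (g ∘ suc) i j)) (+-identityˡ _)

  gen-∈ˢ : ∀ {m} (g : Fin m → V) i → g i ∈ˢ (m , g)
  gen-∈ˢ g i = δ i , λ j → sym (comb-δ g i j)

  span-≤ˢ : ∀ {m} {g : Fin m → V} H → (∀ i → g i ∈ˢ H) → (m , g) ≤ˢ H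
  span-≤ˢ H g∈H v (κ , v≈) = ∈ˢ-resp-≈ᵥ H v≈ (comb-∈ˢ H g∈H κ)

  ≤ˢ-refl : ∀ {A} → A ≤ˢ A
  ≤ˢ-refl v v∈A = v∈A

  ≤ˢ-trans : ∀ {A B C} → A ≤ˢ B → B ≤ˢ C → A ≤ˢ C
  ≤ˢ-trans A≤B B≤C v v∈A = B≤C v (A≤B v v∈A)

  ≤ˢ-+ˢˡ : ∀ A B → A ≤ˢ (A +ˢ B)
  ≤ˢ-+ˢˡ (m , g) (k , h) = span-≤ˢ _ (++⁻ˡ (_∈ˢ _) g (gen-∈ˢ (g ++ h)))

  ≤ˢ-+ˢʳ : ∀ A B → B ≤ˢ (A +ˢ B)
  ≤ˢ-+ˢʳ (m , g) (k , h) = span-≤ˢ _ (++⁻ʳ (_∈ˢ _) g (gen-∈ˢ (g ++ h)))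

  +ˢ-lub : ∀ A B C → A ≤ˢ C → B ≤ˢ C → (A +ˢ B) ≤ˢ C
  +ˢ-lub (m , g) (k , h) C A≤C B≤C =
    span-≤ˢ C (++⁺ (_∈ˢ C) (λ i → A≤C _ (gen-∈ˢ g i)) (λ i → B≤C _ (gen-∈ˢ h i)))

  ∈ˢ-+ˢ⁻ : ∀ {m k} {g : Fin m → V} {h : Fin k → V} {v} → v ∈ˢ ((m , g) +ˢ (k , h)) →
           ∃₂ λ α β → v ≈ᵥ comb g α +ᵥ comb h β
  ∈ˢ-+ˢ⁻ {g = g} {h} (κ , v≈) = _ , _ , λ j → trans (v≈ j) (comb-++ g h κ j)

module SpanOverField {c ℓ} (R : CommutativeRing c ℓ) (isField : IsFieldRing R)
                     (_≟_ : Decidable (CommutativeRing._≈_ R)) (n : ℕ) where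
  open CommutativeRing R hiding (zero)
  open IsFieldRing isField
  open Subspaces R n
  open SpanProperties R n
  open import Relation.Binary.Reasoning.Setoid setoid as ≈-Reasoning using ()
  open import Algebra.Properties.Ring ring using (-1*x≈-x; -‿involutive; -0#≈0#)
  open import Algebra.Properties.CommutativeSemigroup +-commutativeSemigroup using (x∙yz≈y∙xz)

  ·ᵥ-∈ˢ⁻ : ∀ H {a v} → ¬ a ≈ 0# → a ·ᵥ v ∈ˢ H → v ∈ˢ H
  ·ᵥ-∈ˢ⁻ H {a} {v} a≉0 av∈H with inverse a a≉0
  ... | a⁻¹ , a*a⁻¹≈1 = ∈ˢ-resp-≈ᵥ H v≈a⁻¹·av (·ᵥ-∈ˢ H a⁻¹ av∈H)
    where
    v≈a⁻¹·av : v ≈ᵥ a⁻¹ ·ᵥ a ·ᵥ v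
    v≈a⁻¹·av j = begin
      v j              ≈⟨ *-identityˡ (v j) ⟨
      1# * v j         ≈⟨ *-congʳ (trans (*-comm a⁻¹ a) a*a⁻¹≈1) ⟨
      (a⁻¹ * a) * v j  ≈⟨ *-assoc a⁻¹ a (v j) ⟩
      a⁻¹ * (a * v j)  ∎
      where open ≈-Reasoning

  ∈ˢ-exchange : ∀ H {a v u} → ¬ a ≈ 0# → (a ·ᵥ v +ᵥ u) ∈ˢ H → u ∈ˢ H → v ∈ˢ H
  ∈ˢ-exchange H {a} {v} {u} a≉0 av+u∈H u∈H =
    ·ᵥ-∈ˢ⁻ H a≉0 (∈ˢ-resp-≈ᵥ H av≈ (+ᵥ-∈ˢ H av+u∈H (·ᵥ-∈ˢ H (- 1#) u∈H)))
    where
    av≈ : a ·ᵥ v ≈ᵥ (a ·ᵥ v +ᵥ u) +ᵥ (- 1#) ·ᵥ u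
    av≈ j = begin
      a * v j                        ≈⟨ +-identityʳ (a * v j) ⟨
      a * v j + 0#                   ≈⟨ +-congˡ (-‿inverseʳ (u j)) ⟨
      a * v j + (u j - u j)          ≈⟨ +-assoc (a * v j) (u j) (- u j) ⟨
      (a * v j + u j) - u j          ≈⟨ +-congˡ (-1*x≈-x (u j)) ⟨
      (a * v j + u j) + - 1# * u j   ∎
      where open ≈-Reasoning

  LinIndep-tail : ∀ {d} {b : Fin (suc d) → V} → LinIndep b → LinIndep (b ∘ suc)
  LinIndep-tail b-indep κ κb≈0 i =
    b-indep (0# ∷ κ) (λ j → trans (+-cong (zeroˡ _) (κb≈0 j)) (+-identityˡ 0#)) (suc i)

  head∉span-tail : ∀ {d} {b : Fin (suc d) → V} → LinIndep b → ¬ (b zero ∈ˢ (d , b ∘ suc))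
  head∉span-tail {b = b} b-indep (α , b₀≈) = 1≉0 (begin
    1#       ≈⟨ -‿involutive 1# ⟨
    - (- 1#) ≈⟨ -‿cong (b-indep ((- 1#) ∷ α) dependence zero) ⟩
    - 0#     ≈⟨ -0#≈0# ⟩
    0#       ∎)
    where
    open ≈-Reasoning
    dependence : comb b ((- 1#) ∷ α) ≈ᵥ 0ᵥ
    dependence j = trans (+-cong (-1*x≈-x (b zero j)) (sym (b₀≈ j))) (-‿inverseˡ (b zero j))

  ∉⇒≉0ᵥ : ∀ A {v} → ¬ v ∈ˢ A → ¬ v ≈ᵥ 0ᵥ
  ∉⇒≉0ᵥ A v∉A v≈0 = v∉A (∈ˢ-resp-≈ᵥ A v≈0 (0ᵥ-∈ˢ A))

  ⟨v⟩-dim : ∀ {v} → ¬ v ≈ᵥ 0ᵥ → HasDim ⟨ v ⟩ 1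
  ⟨v⟩-dim {v} v≉0 = (λ _ → v) , v-indep , ≤ˢ-refl {⟨ v ⟩} , ≤ˢ-refl {⟨ v ⟩}
    where
    v-indep : LinIndep {1} (λ _ → v)
    v-indep κ κv≈0 zero = decidable-stable (κ zero ≟ 0#) λ κ₀≉0 →
      v≉0 (proj₂ (·ᵥ-∈ˢ⁻ 0ˢ κ₀≉0 ((λ ()) , λ j → trans (sym (+-identityʳ _)) (κv≈0 j))))

  ∉⇒meet-0ˢ : ∀ A {v} → ¬ v ∈ˢ A → IsMeet A ⟨ v ⟩ 0ˢ
  ∉⇒meet-0ˢ A {v} v∉A w = ∈0ˢ⇒∈both , ∈both⇒∈0ˢ
    where
    ∈0ˢ⇒∈both : w ∈ˢ 0ˢ → w ∈ˢ A × w ∈ˢ ⟨ v ⟩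
    ∈0ˢ⇒∈both (_ , w≈0) = ∈ˢ-resp-≈ᵥ A w≈0 (0ᵥ-∈ˢ A) , ∈ˢ-resp-≈ᵥ ⟨ v ⟩ w≈0 (0ᵥ-∈ˢ ⟨ v ⟩)
    ∈both⇒∈0ˢ : w ∈ˢ A × w ∈ˢ ⟨ v ⟩ → w ∈ˢ 0ˢ
    ∈both⇒∈0ˢ (w∈A , κ , w≈κv) with κ zero ≟ 0#
    ... | yes κ₀≈0 = (λ ()) , λ j →
      trans (w≈κv j) (trans (+-identityʳ _) (trans (*-congʳ κ₀≈0) (zeroˡ (v j))))
    ... | no κ₀≉0 = ⊥-elim (v∉A (·ᵥ-∈ˢ⁻ A κ₀≉0
      (∈ˢ-resp-≈ᵥ A (λ j → sym (trans (w≈κv j) (+-identityʳ _))) w∈A)))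

  span-removeAt-≤ˢ : ∀ {k} (y : Fin (suc k) → V) l H →
                     (k , removeAt y l) ≤ˢ H → y l ∈ˢ H → (suc k , y) ≤ˢ H
  span-removeAt-≤ˢ y l H rest≤H yₗ∈H = span-≤ˢ H y∈H
    where
    y∈H : ∀ i → y i ∈ˢ H
    y∈H i with l Fin.≟ i
    ... | yes ≡.refl = yₗ∈H
    ... | no l≢i = ≡.subst (_∈ˢ H) (≡.cong y (FinP.punchIn-punchOut l≢i))
                           (rest≤H _ (gen-∈ˢ (removeAt y l) (punchOut l≢i)))

  record Completion {d m} (b : Fin d → V) (x : Fin m → V) : Set (c ⊔ ℓ) where
    constructor completion
    field
      {size} : ℕ
      extra  : Fin size → V
      fits   : d ℕ.+ size ℕ.≤ m
      spans  : (m , x) ≤ˢ ((d , b) +ˢ (size , extra))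

  -- As β l ≉ 0, the vector y l lies in the span of b and the other y's,
  -- so it can be exchanged for b zero.
  exchange-extra : ∀ {d m k} {b : Fin (suc d) → V} {x : Fin m → V} (y : Fin k → V) →
    d ℕ.+ k ℕ.≤ m → (m , x) ≤ˢ ((d , b ∘ suc) +ˢ (k , y)) →
    ∀ α β → b zero ≈ᵥ comb (b ∘ suc) α +ᵥ comb y β → ∀ l → ¬ β l ≈ 0# → Completion b x
  exchange-extra {d} {m} {suc k} {b} y d+k≤m X≤ α β b₀≈ l βₗ≉0 =
    completion y′ (≡.subst (ℕ._≤ m) (ℕP.+-suc d k) d+k≤m) (≤ˢ-trans {B = B′+Y} {C = T} X≤ B′+Y≤T)
    where
    y′ : Fin k → V
    y′ = removeAt y l
    T : Gens
    T = (suc d , b) +ˢ (k , y′)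
    b∈T : ∀ i → b i ∈ˢ T
    b∈T i = ≤ˢ-+ˢˡ (suc d , b) (k , y′) _ (gen-∈ˢ b i)
    b′≤T : (d , b ∘ suc) ≤ˢ T
    b′≤T = span-≤ˢ T (b∈T ∘ suc)
    y′≤T : (k , y′) ≤ˢ T
    y′≤T = ≤ˢ-+ˢʳ (suc d , b) (k , y′)
    rest : V
    rest = comb (b ∘ suc) α +ᵥ comb y′ (removeAt β l)
    b₀≈βₗyₗ+rest : b zero ≈ᵥ β l ·ᵥ y l +ᵥ rest
    b₀≈βₗyₗ+rest j = trans (b₀≈ j) (trans (+-congˡ (comb-removeAt y β l j)) (x∙yz≈y∙xz _ _ _))
    yₗ∈T : y l ∈ˢ T
    yₗ∈T = ∈ˢ-exchange T βₗ≉0 (∈ˢ-resp-≈ᵥ T (λ j → sym (b₀≈βₗyₗ+rest j)) (b∈T zero))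
             (+ᵥ-∈ˢ T (comb-∈ˢ T (b∈T ∘ suc) α) (comb-∈ˢ T (λ i → y′≤T _ (gen-∈ˢ y′ i)) _))
    B′+Y : Gens
    B′+Y = (d , b ∘ suc) +ˢ (suc k , y)
    B′+Y≤T : B′+Y ≤ˢ T
    B′+Y≤T = +ˢ-lub (d , b ∘ suc) (suc k , y) T b′≤T (span-removeAt-≤ˢ y l T y′≤T yₗ∈T)

  completion-∷ : ∀ {d m} {b : Fin (suc d) → V} {x : Fin m → V} →
                 LinIndep b → b zero ∈ˢ (m , x) → Completion (b ∘ suc) x → Completion b x
  completion-∷ {b = b} b-indep b₀∈X (completion y d+k≤m X≤)
    with ∈ˢ-+ˢ⁻ {g = b ∘ suc} {h = y} (X≤ _ b₀∈X)
  ... | α , β , b₀≈ with FinP.any? (λ l → ¬? (β l ≟ 0#))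
  ...   | yes (l , βₗ≉0) = exchange-extra {b = b} y d+k≤m X≤ α β b₀≈ l βₗ≉0
  ...   | no ∄βₗ≉0 = ⊥-elim (head∉span-tail {b = b} b-indep (α , b₀∈span-tail))
    where
    b₀∈span-tail : b zero ≈ᵥ comb (b ∘ suc) α
    b₀∈span-tail j = trans (b₀≈ j) (trans (+-congˡ (comb-zero y β≈0 j)) (+-identityʳ _))
      where
      β≈0 : ∀ l → β l ≈ 0#
      β≈0 l = decidable-stable (β l ≟ 0#) (λ βₗ≉0 → ∄βₗ≉0 (l , βₗ≉0))

  steinitz : ∀ {d m} {b : Fin d → V} {x : Fin m → V} →
             LinIndep b → (∀ i → b i ∈ˢ (m , x)) → Completion b x
  steinitz {zero} {m} {b} {x} _ _ = completion x ℕP.≤-refl (≤ˢ-+ˢʳ (0 , b) (m , x))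
  steinitz {suc d} {b = b} b-indep b∈X =
    completion-∷ b-indep (b∈X zero)
      (steinitz {b = b ∘ suc} (LinIndep-tail {b = b} b-indep) (b∈X ∘ suc))

  module _ {ρ : Gens → ℕ} (M : IsQMatroid ρ) where
    open IsQMatroid M

    -- Membership in A need not be decidable, but the goal is a decidable
    -- inequality of naturals, so we may split on v ∈ˢ A under a double negation.
    ρ[A+⟨v⟩]≤ρ[A]+1 : ∀ A v → ρ (A +ˢ ⟨ v ⟩) ℕ.≤ ρ A ℕ.+ 1
    ρ[A+⟨v⟩]≤ρ[A]+1 A v =
      decidable-stable (_ ℕ.≤? _) (λ ≰ → ≰ (if-∉ (λ v∈A → ≰ (if-∈ v∈A))))
      where
      open ℕP.≤-Reasoning
      if-∈ : v ∈ˢ A → ρ (A +ˢ ⟨ v ⟩) ℕ.≤ ρ A ℕ.+ 1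
      if-∈ v∈A = begin
        ρ (A +ˢ ⟨ v ⟩) ≤⟨ monotone _ A (+ˢ-lub A ⟨ v ⟩ A (≤ˢ-refl {A}) (span-≤ˢ A (λ _ → v∈A))) ⟩
        ρ A            ≤⟨ ℕP.m≤m+n (ρ A) 1 ⟩
        ρ A ℕ.+ 1      ∎
      if-∉ : ¬ v ∈ˢ A → ρ (A +ˢ ⟨ v ⟩) ℕ.≤ ρ A ℕ.+ 1
      if-∉ v∉A = begin
        ρ (A +ˢ ⟨ v ⟩)           ≤⟨ ℕP.m≤m+n _ (ρ 0ˢ) ⟩
        ρ (A +ˢ ⟨ v ⟩) ℕ.+ ρ 0ˢ  ≤⟨ submodular A ⟨ v ⟩ 0ˢ (∉⇒meet-0ˢ A v∉A) ⟩
        ρ A ℕ.+ ρ ⟨ v ⟩          ≤⟨ ℕP.+-monoʳ-≤ (ρ A) (bounded ⟨ v ⟩ 1 (⟨v⟩-dim (∉⇒≉0ᵥ A v∉A))) ⟩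
        ρ A ℕ.+ 1                ∎

    ρ[A+Y]≤ρ[A]+|Y| : ∀ A {k} (y : Fin k → V) → ρ (A +ˢ (k , y)) ℕ.≤ ρ A ℕ.+ k
    ρ[A+Y]≤ρ[A]+|Y| A {zero} y = begin
      ρ (A +ˢ (0 , y)) ≤⟨ monotone _ A A+Y≤A ⟩
      ρ A              ≤⟨ ℕP.m≤m+n (ρ A) 0 ⟩
      ρ A ℕ.+ 0        ∎
      where
      open ℕP.≤-Reasoning
      A+Y≤A : (A +ˢ (0 , y)) ≤ˢ A
      A+Y≤A = +ˢ-lub A (0 , y) A (≤ˢ-refl {A}) (span-≤ˢ {g = y} A (λ ()))
    ρ[A+Y]≤ρ[A]+|Y| A {suc k} y = begin
      ρ (A +ˢ (suc k , y))          ≤⟨ monotone _ _ A+Y≤A′+Y′ ⟩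
      ρ (A′ +ˢ (k , y ∘ suc))       ≤⟨ ρ[A+Y]≤ρ[A]+|Y| A′ (y ∘ suc) ⟩
      ρ A′ ℕ.+ k                    ≤⟨ ℕP.+-monoˡ-≤ k (ρ[A+⟨v⟩]≤ρ[A]+1 A (y zero)) ⟩
      ρ A ℕ.+ 1 ℕ.+ k               ≡⟨ ℕP.+-assoc (ρ A) 1 k ⟩
      ρ A ℕ.+ suc k                 ∎
      where
      open ℕP.≤-Reasoning
      A′ T : Gens
      A′ = A +ˢ ⟨ y zero ⟩
      T = A′ +ˢ (k , y ∘ suc)
      A′≤T : A′ ≤ˢ T
      A′≤T = ≤ˢ-+ˢˡ A′ (k , y ∘ suc)
      y∈T : ∀ i → y i ∈ˢ T
      y∈T zero    = A′≤T _ (≤ˢ-+ˢʳ A ⟨ y zero ⟩ _ (gen-∈ˢ (λ _ → y zero) zero))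
      y∈T (suc i) = ≤ˢ-+ˢʳ A′ (k , y ∘ suc) _ (gen-∈ˢ (y ∘ suc) i)
      A+Y≤A′+Y′ : (A +ˢ (suc k , y)) ≤ˢ T
      A+Y≤A′+Y′ = +ˢ-lub A (suc k , y) T
        (≤ˢ-trans {A} {A′} {T} (≤ˢ-+ˢˡ A ⟨ y zero ⟩) A′≤T) (span-≤ˢ T y∈T)

    dim≤ρ-of-≤ˢ-independent : ∀ {X J d} → Independent ρ X → J ≤ˢ X → HasDim J d → d ℕ.≤ ρ J
    dim≤ρ-of-≤ˢ-independent {X} {J} {d} (m , (x , _ , x≃X) , ρX≡m) J≤X (b , b-indep , b≃J)
      with steinitz {b = b} {x} b-indep (λ i → proj₂ x≃X _ (J≤X _ (proj₁ b≃J _ (gen-∈ˢ b i))))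
    ... | completion {k} y d+k≤m X≤B+Y = ℕP.+-cancelʳ-≤ k d (ρ J) (ℕP.≤-trans d+k≤m m≤ρJ+k)
      where
      open ℕP.≤-Reasoning
      m≤ρJ+k : m ℕ.≤ ρ J ℕ.+ k
      m≤ρJ+k = begin
        m                          ≡⟨ ρX≡m ⟨
        ρ X                        ≤⟨ monotone X _ (≤ˢ-trans {X} {m , x} {B+Y} (proj₂ x≃X) X≤B+Y) ⟩
        ρ B+Y                      ≤⟨ ρ[A+Y]≤ρ[A]+|Y| (d , b) y ⟩
        ρ (d , b) ℕ.+ k            ≡⟨ ≡.cong (ℕ._+ k) (well-defined (d , b) J b≃J) ⟩
        ρ J ℕ.+ k                  ∎
        where
        B+Y : Gens
        B+Y = (d , b) +ˢ (k , y)

-- The only use of the finiteness of the field.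
≈-decidable : ∀ {c ℓ q} (F : FiniteField c ℓ q) →
              Decidable (CommutativeRing._≈_ (FiniteField.ring F))
≈-decidable F = via-injection
  (Inverse⇒Injection (Symmetry.inverse (Bijection⇒Inverse (FiniteField.counting F)))) FinP._≟_

proposition4p13 : ∀ {c ℓ} (q : ℕ) → IsPrimePower q → (F : FiniteField c ℓ q) → (n : ℕ) →
    let open Subspaces (FiniteField.ring F) n in
    (ρ₁ ρ₂ : Gens → ℕ) → IsQMatroid ρ₁ → IsQMatroid ρ₂ →
    (λ' : ℚ) → 0ℚ < λ' → λ' < 1ℚ →
    ∀ (X : Gens) → (Independent ρ₁ X ⊎ Independent ρ₂ X) →
    μIndependent (denom λ') (mixRank λ' ρ₁ ρ₂) X
proposition4p13 q _ F n ρ₁ ρ₂ M₁ M₂ λ' 0<λ λ<1 X X-indep J J≤X d J-dim =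
  convex-denom-bound λ' 0<λ λ<1 (Sum.map (dim≤ρ M₁) (dim≤ρ M₂) X-indep)
  where
  open Subspaces (FiniteField.ring F) n
  open SpanOverField (FiniteField.ring F) (FiniteField.isField F) (≈-decidable F) n
  dim≤ρ : ∀ {ρ} → IsQMatroid ρ → Independent ρ X → d ℕ.≤ ρ J
  dim≤ρ M X-indep = dim≤ρ-of-≤ˢ-independent M X-indep J≤X J-dim
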